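{- Let $\mathcal{M}$ be a linear hypermap (in the sense of the context) with flag set $\Phi$ and flag involutions $r_0,r_1,r_2$. Then for every $\phi\in\Phi$, $$\phi^{\langle r_1,r_2\rangle\langle r_0,r_2\rangle}\cap \phi^{\langle r_0,r_2\rangle\langle r_1,r_2\rangle}=\phi^{\langle r_1,r_2\rangle\cup\langle r_0,r_2\rangle}.$$
   Context: A hypergraph $\mathcal H=(V,X)$ is linear if any two distinct vertices lie in at most one common hyperedge. A graph $\Gamma$ on $V$ is an associated graph of $\mathcal H$ if for every $x\in X$ the induced subgraph $\Gamma[x]$ is a cycle (for $|x|=2$ a pair of parallel edges, for $|x|=1$ a loop), and every edge of $\Gamma$ has both ends in a unique hyperedge $y\in X$. A linear hypermap $\mathcal M$ is a 2-cell embedding of an associated graph $\Gamma$ of a connected linear hypergraph $\mathcal H$ in a compact connected surface without boundary such that for each $x\in X$, $\Gamma[x]$ bounds a 2-cell (a hyperedge of $\mathcal M$) and each edge of $\Gamma$ is incident with exactly two distinct 2-cells; the other 2-cells are hyperfaces. Standing assumption: $\mathcal H$ has more than one hyperedge and no hyperedge of size 1. Each edge $\xi$ lies on exactly one hyperedge and one hyperface. A flag is an arc $(v,\xi)$ ($v$ an end of edge $\xi$), with its vertex $v$ and the hyperedge and hyperface containing $\xi$; $\Phi$ is the set of flags. Involutions: $r_0:(v,\xi)\mapsto(v',\xi)$, $v'$ the other end of $\xi$; $r_1:(v,\xi)\mapsto(v,\xi')$, $\xi'$ the other edge at $v$ bounding the same hyperface corner as $\xi$ (same vertex and hyperface, other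 hyperedge); $r_2:(v,\xi)\mapsto(v,\xi'')$, $\xi''$ the other edge at $v$ on the boundary of the same hyperedge (same vertex and hyperedge, other hyperface). Permutations act on the right, $\phi^{gh}=(\phi^g)^h$; for subsets $A,B$ of a permutation group, $AB=\{ab:a\in A,b\in B\}$ and $\phi^S=\{\phi^s:s\in S\}$. -}

module Defs where

open import Data.Nat using (ℕ)
open import Data.Fin using (Fin)
open import Data.List using (List; []; _∷_; foldl)
open import Data.List.Relation.Unary.All using (All)
open import Data.Product using (Σ; _×_; ∃; ∃-syntax)
open import Data.Sum using (_⊎_)
open import Relation.Binary.PropositionalEquality using (_≡_; _≢_)
open import Relation.Nullary using (¬_)

data Gen : Set where
  g0 g1 g2 : Gen

-- Words in the generators represent elements of the permutation group
-- ⟨r₀,r₁,r₂⟩; a set of such elements is a predicate on words.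
Word : Set
Word = List Gen

S12 : Gen → Set
S12 g = g ≡ g1 ⊎ g ≡ g2

S02 : Gen → Set
S02 g = g ≡ g0 ⊎ g ≡ g2

S012 : Gen → Set
S012 g = g ≡ g0 ⊎ g ≡ g1 ⊎ g ≡ g2

-- ⟨S⟩ : the subgroup generated by S (as words over S; the r_i are involutions,
-- so inverses are again words over S).
⟨_⟩ : (Gen → Set) → Word → Set
⟨ S ⟩ w = All S w

record Hypermap : Set where
  field
    n  : ℕ
    r  : Gen → Fin n → Fin n
    involutive   : ∀ g φ → r g (r g φ) ≡ φ
    fixpointFree : ∀ g φ → r g φ ≢ φ

  Flag : Set
  Flag = Fin n

  act : Flag → Word → Flag
  act φ w = foldl (λ ψ g → r g ψ) φ w

  orb : Flag → (Word → Set) → Flag → Set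
  orb φ A ψ = ∃[ a ] (A a × act φ a ≡ ψ)

  orbProd : Flag → (Word → Set) → (Word → Set) → Flag → Set
  orbProd φ A B ψ = ∃[ a ] ∃[ b ] (A a × B b × act (act φ a) b ≡ ψ)

  orbUnion : Flag → (Word → Set) → (Word → Set) → Flag → Set
  orbUnion φ A B ψ = ∃[ a ] ((A a ⊎ B a) × act φ a ≡ ψ)

  SameV : Flag → Flag → Set
  SameV φ ψ = orb φ ⟨ S12 ⟩ ψ

  SameE : Flag → Flag → Set
  SameE φ ψ = orb φ ⟨ S02 ⟩ ψ

record LinearHypermap : Set where
  field
    hm : Hypermap
  open Hypermap hm public
  field
    connected : ∀ φ ψ → orb φ ⟨ S012 ⟩ ψ
    -- Γ[x] is a cycle: the boundary of a hyperedge passes through each of its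
    -- vertices exactly once, so a vertex and a hyperedge share ≤ 2 flags
    -- (φ and φ r₂)
    cycle : ∀ φ ψ → SameV φ ψ → SameE φ ψ → ψ ≡ φ ⊎ ψ ≡ r g2 φ
    manyHyperedges : ∀ φ → ∃[ ψ ] (¬ SameE φ ψ)
    -- linearity: two distinct vertices v,w lying both in hyperedge x and in
    -- hyperedge y force x = y.  Here α₁,β₁ are flags of x at v,w and α₂,β₂
    -- flags of y at v,w.
    linear : ∀ α₁ β₁ α₂ β₂ →
      ¬ SameV α₁ β₁ → SameE α₁ β₁ → SameE α₂ β₂ →
      SameV α₁ α₂ → SameV β₁ β₂ → SameE α₁ α₂

{-# OPTIONS --safe #-}
-- If ψ = φ a b = φ c d with a, d ∈ ⟨r₁,r₂⟩ and b, c ∈ ⟨r₀,r₂⟩, then φ, φc lie on one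
-- hyperedge and φa, ψ on another, while φ, φa share a vertex and so do φc, ψ.  Either
-- φ and φc share a vertex, and then so do φ and ψ; or they do not, and linearity
-- identifies the two hyperedges, so φ and ψ share a hyperedge.  Deciding which case
-- holds needs decidability of orbits: on a finite flag set every orbit element is
-- reached by a word of length at most the number of flags (pigeonhole on prefixes).
module Submission where

open import Defs
open import Data.Fin using (toℕ)
open import Data.Fin.Properties using (pigeonhole; toℕ<n; _≟_)
open import Data.List using (List; []; _∷_; _++_; length; take; drop)
open import Data.List.Properties using (foldl-++; length-++; length-take; length-drop; take++drop≡id)
open import Data.List.Relation.Unary.All using (All; []; _∷_)
open import Data.List.Relation.Unary.All.Properties using (++⁺; take⁺; drop⁺)
open import Data.Nat using (ℕ; zero; suc; _≤_; _<_; z≤n; s≤s; _∸_; _+_; _⊓_; _<?_)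
open import Data.Nat.Induction using (<-wellFounded)
open import Data.Nat.Properties
  using (≤-trans; ≤-pred; <⇒≤; n<1+n; ≮⇒≥; m⊓n≤m; +-monoˡ-≤; +-monoˡ-<; m+[n∸m]≡n; module ≤-Reasoning)
open import Data.Product using (_×_; _,_; ∃; ∃-syntax)
open import Data.Sum using (_⊎_; inj₁; inj₂)
open import Induction.WellFounded using (Acc; acc)
open import Relation.Binary.PropositionalEquality using (_≡_; refl; sym; trans; cong; cong₂; module ≡-Reasoning)
open import Relation.Nullary using (Dec; yes; no)
open import Relation.Nullary.Decidable using (map′; _⊎-dec_; _×-dec_)
open import Relation.Unary using (Decidable)

∃-Gen? : {P : Gen → Set} → Decidable P → Dec (∃ P)
∃-Gen? P? with P? g0 | P? g1 | P? g2
... | yes p | _     | _     = yes (g0 , p)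
... | no _  | yes p | _     = yes (g1 , p)
... | no _  | no _  | yes p = yes (g2 , p)
... | no ¬p₀ | no ¬p₁ | no ¬p₂ = no λ { (g0 , p) → ¬p₀ p ; (g1 , p) → ¬p₁ p ; (g2 , p) → ¬p₂ p }

S12? : Decidable S12
S12? g0 = no λ { (inj₁ ()) ; (inj₂ ()) }
S12? g1 = yes (inj₁ refl)
S12? g2 = yes (inj₂ refl)

length-take++drop< : ∀ {A : Set} {i j} (xs : List A) → i < j → j ≤ length xs →
                     length (take i xs ++ drop j xs) < length xs
length-take++drop< {i = i} {j} xs i<j j≤L = begin-strict
  length (take i xs ++ drop j xs)         ≡⟨ length-++ (take i xs) ⟩
  length (take i xs) + length (drop j xs) ≡⟨ cong₂ _+_ (length-take i xs) (length-drop j xs) ⟩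
  i ⊓ L + (L ∸ j)                         ≤⟨ +-monoˡ-≤ (L ∸ j) (m⊓n≤m i L) ⟩
  i + (L ∸ j)                             <⟨ +-monoˡ-< (L ∸ j) i<j ⟩
  j + (L ∸ j)                             ≡⟨ m+[n∸m]≡n j≤L ⟩
  L                                       ∎
  where
  open ≤-Reasoning
  L = length xs

module _ (H : Hypermap) where
  open Hypermap H

  act-++ : ∀ φ a b → act φ (a ++ b) ≡ act (act φ a) b
  act-++ = foldl-++ (λ ψ g → r g ψ)

  orb-trans : ∀ {S φ χ ψ} → orb φ ⟨ S ⟩ χ → orb χ ⟨ S ⟩ ψ → orb φ ⟨ S ⟩ ψ
  orb-trans {φ = φ} (a , sa , refl) (b , sb , refl) = a ++ b , ++⁺ sa sb , act-++ φ a b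

  orb⊆orbUnionˡ : ∀ {A B φ ψ} → orb φ A ψ → orbUnion φ A B ψ
  orb⊆orbUnionˡ (a , sa , e) = a , inj₁ sa , e

  orb⊆orbUnionʳ : ∀ {A B φ ψ} → orb φ B ψ → orbUnion φ A B ψ
  orb⊆orbUnionʳ (b , sb , e) = b , inj₂ sb , e

  orb⊆orbProdʳ : ∀ {A B φ ψ} → B [] → orb φ A ψ → orbProd φ A B ψ
  orb⊆orbProdʳ b[] (a , sa , e) = a , [] , sa , b[] , e

  orb⊆orbProdˡ : ∀ {A B φ ψ} → A [] → orb φ B ψ → orbProd φ A B ψ
  orb⊆orbProdˡ a[] (b , sb , e) = [] , b , a[] , sb , e

  orbUnion⊆orbProd∩orbProd : ∀ {A B φ ψ} → A [] → B [] →
                             orbUnion φ A B ψ → orbProd φ A B ψ × orbProd φ B A ψ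
  orbUnion⊆orbProd∩orbProd a[] b[] (a , inj₁ sa , e) = orb⊆orbProdʳ b[] (a , sa , e) , orb⊆orbProdˡ b[] (a , sa , e)
  orbUnion⊆orbProd∩orbProd a[] b[] (b , inj₂ sb , e) = orb⊆orbProdˡ a[] (b , sb , e) , orb⊆orbProdʳ a[] (b , sb , e)

  act-skip-loop : ∀ φ w i j → act φ (take i w) ≡ act φ (take j w) →
                  act φ (take i w ++ drop j w) ≡ act φ w
  act-skip-loop φ w i j loop = begin
    act φ (take i w ++ drop j w)      ≡⟨ act-++ φ (take i w) (drop j w) ⟩
    act (act φ (take i w)) (drop j w) ≡⟨ cong (λ χ → act χ (drop j w)) loop ⟩
    act (act φ (take j w)) (drop j w) ≡⟨ sym (act-++ φ (take j w) (drop j w)) ⟩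
    act φ (take j w ++ drop j w)      ≡⟨ cong (act φ) (take++drop≡id j w) ⟩
    act φ w                           ∎
    where open ≡-Reasoning

  module _ {S : Gen → Set} where

    OrbWithin : ℕ → Flag → Flag → Set
    OrbWithin k φ ψ = ∃[ w ] (length w ≤ k × All S w × act φ w ≡ ψ)

    shorter-word : ∀ φ w → n < length w → All S w →
                   ∃[ w′ ] (length w′ < length w × All S w′ × act φ w′ ≡ act φ w)
    shorter-word φ w n<L sw with pigeonhole (n<1+n n) (λ k → act φ (take (toℕ k) w))
    ... | i , j , i<j , loop =
      take (toℕ i) w ++ drop (toℕ j) w ,
      length-take++drop< w i<j (≤-trans (≤-pred (toℕ<n j)) (<⇒≤ n<L)) ,
      ++⁺ (take⁺ (toℕ i) sw) (drop⁺ (toℕ j) sw) ,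
      act-skip-loop φ w (toℕ i) (toℕ j) loop

    short-word : ∀ φ w → All S w → OrbWithin n φ (act φ w)
    short-word φ w sw = go w sw (<-wellFounded (length w))
      where
      go : ∀ w → All S w → Acc _<_ (length w) → OrbWithin n φ (act φ w)
      go w sw (acc rec) with n <? length w
      ... | no n≮L = w , ≮⇒≥ n≮L , sw , refl
      ... | yes n<L with shorter-word φ w n<L sw
      ...   | w′ , lt , sw′ , e with go w′ sw′ (rec lt)
      ...     | w″ , l″ , sw″ , e″ = w″ , l″ , sw″ , trans e″ e

    module _ (S? : Decidable S) where

      orbWithin? : ∀ k φ ψ → Dec (OrbWithin k φ ψ)
      orbWithin? zero φ ψ = map′ (λ e → [] , z≤n , [] , e) from (φ ≟ ψ)
        where
        from : OrbWithin zero φ ψ → φ ≡ ψ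
        from ([] , _ , _ , e) = e
      orbWithin? (suc k) φ ψ =
        map′ to from ((φ ≟ ψ) ⊎-dec ∃-Gen? (λ g → S? g ×-dec orbWithin? k (r g φ) ψ))
        where
        to : φ ≡ ψ ⊎ ∃[ g ] (S g × OrbWithin k (r g φ) ψ) → OrbWithin (suc k) φ ψ
        to (inj₁ e) = [] , z≤n , [] , e
        to (inj₂ (g , sg , w , l , sw , e)) = g ∷ w , s≤s l , sg ∷ sw , e
        from : OrbWithin (suc k) φ ψ → φ ≡ ψ ⊎ ∃[ g ] (S g × OrbWithin k (r g φ) ψ)
        from ([] , _ , _ , e) = inj₁ e
        from (g ∷ w , s≤s l , sg ∷ sw , e) = inj₂ (g , sg , w , l , sw , e)

      orb? : ∀ φ ψ → Dec (orb φ ⟨ S ⟩ ψ)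
      orb? φ ψ = map′ (λ (w , _ , sw , e) → w , sw , e) from (orbWithin? n φ ψ)
        where
        from : orb φ ⟨ S ⟩ ψ → OrbWithin n φ ψ
        from (w , sw , refl) = short-word φ w sw

module _ (M : LinearHypermap) where
  open LinearHypermap M

  orbProd∩orbProd⊆orbUnion : ∀ {φ ψ} →
    orbProd φ ⟨ S12 ⟩ ⟨ S02 ⟩ ψ → orbProd φ ⟨ S02 ⟩ ⟨ S12 ⟩ ψ → orbUnion φ ⟨ S12 ⟩ ⟨ S02 ⟩ ψ
  orbProd∩orbProd⊆orbUnion {φ} {ψ} (a , b , sa , sb , eab) (c , d , sc , sd , ecd)
    with orb? hm S12? φ (act φ c)
  ... | yes φ∼φc = orb⊆orbUnionˡ hm (orb-trans hm φ∼φc (d , sd , ecd))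
  ... | no φ≁φc = orb⊆orbUnionʳ hm (orb-trans hm φ≈φa (b , sb , eab))
    where
    φ≈φa : SameE φ (act φ a)
    φ≈φa = linear φ (act φ c) (act φ a) ψ φ≁φc (c , sc , refl) (b , sb , eab) (a , sa , refl) (d , sd , ecd)

proposition2p5 : (M : LinearHypermap) → let open LinearHypermap M in
    (φ ψ : Flag) →
    ((orbProd φ ⟨ S12 ⟩ ⟨ S02 ⟩ ψ × orbProd φ ⟨ S02 ⟩ ⟨ S12 ⟩ ψ) → orbUnion φ ⟨ S12 ⟩ ⟨ S02 ⟩ ψ)
    × (orbUnion φ ⟨ S12 ⟩ ⟨ S02 ⟩ ψ → (orbProd φ ⟨ S12 ⟩ ⟨ S02 ⟩ ψ × orbProd φ ⟨ S02 ⟩ ⟨ S12 ⟩ ψ))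
proposition2p5 M φ ψ =
  (λ (p , q) → orbProd∩orbProd⊆orbUnion M p q) , orbUnion⊆orbProd∩orbProd (LinearHypermap.hm M) [] []
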